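{- Let $n=p_1^{a_1}\cdots p_r^{a_r}>1$ be the prime factorization of $n$, and suppose that all exponents $a_i$ ($i=1,\dots,r$) are odd. Then $n$ is bi-unitary harmonic if and only if $n$ is harmonic.
   Context: $\sigma(n)$ and $d(n)$ denote the sum and the number of positive divisors of $n$; $n$ is harmonic if $\sigma(n)\mid n\,d(n)$. A divisor $d$ of $n$ is a unitary divisor if $\gcd(d,n/d)=1$; a divisor $d$ of $n$ is a bi-unitary divisor if the greatest common unitary divisor of $d$ and $n/d$ is $1$. $\sigma^{**}(n)$ denotes the sum and $d^{**}(n)$ the number of bi-unitary divisors of $n$. $n$ is bi-unitary harmonic if $\sigma^{**}(n)\mid n\,d^{**}(n)$. -}

module Defs where

open import Data.Nat using (ℕ; zero; suc; _+_; _*_; _^_; _≤_; _<_; _⊔_)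
open import Data.Nat.DivMod using (_/_; _%_)
open import Data.Nat.Divisibility using (_∣_; _∣?_)
open import Data.Nat.GCD using (gcd)
open import Data.Nat.Primality using (Prime)
open import Data.Nat.Properties using (_≟_)
open import Data.List using (List; filter; map; upTo; length; foldr)
open import Data.Nat.ListAction using (sum)
open import Data.List.Membership.DecPropositional _≟_ using (_∈?_)
open import Relation.Binary.PropositionalEquality using (_≡_)
open import Relation.Nullary.Decidable using (_×-dec_)
open import Relation.Nullary using (¬_)

-- cofactor n / d (with the convention n / 0 = 0; only used for d ≥ 1)
cof : ℕ → ℕ → ℕ
cof n zero    = 0
cof n (suc k) = n / suc k

divisors : ℕ → List ℕ
divisors n = filter (_∣? n) (map suc (upTo n))

σ : ℕ → ℕ
σ n = sum (divisors n)

τ : ℕ → ℕ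
τ n = length (divisors n)

unitaryDivisors : ℕ → List ℕ
unitaryDivisors n = filter (λ d → gcd d (cof n d) ≟ 1) (divisors n)

gcud : ℕ → ℕ → ℕ
gcud a b = foldr _⊔_ 0 (filter (λ e → e ∈? unitaryDivisors b) (unitaryDivisors a))

biUnitaryDivisors : ℕ → List ℕ
biUnitaryDivisors n = filter (λ d → gcud d (cof n d) ≟ 1) (divisors n)

σ** : ℕ → ℕ
σ** n = sum (biUnitaryDivisors n)

d** : ℕ → ℕ
d** n = length (biUnitaryDivisors n)

Harmonic : ℕ → Set
Harmonic n = σ n ∣ n * τ n

BiUnitaryHarmonic : ℕ → Set
BiUnitaryHarmonic n = σ** n ∣ n * d** n

-- every exponent in the prime factorisation of n is odd:
-- whenever p is prime and p^a exactly divides n with a ≥ 1, a is odd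
AllExponentsOdd : ℕ → Set
AllExponentsOdd n = ∀ p a → Prime p → 1 ≤ a → p ^ a ∣ n → ¬ (p ^ suc a ∣ n) → a % 2 ≡ 1

-- Under the hypothesis every divisor of n is bi-unitary, so the lists
-- biUnitaryDivisors n and divisors n coincide and σ** n = σ n, d** n = τ n.
-- Let n = d·m and let e > 1 be a unitary divisor of both d and m; take a prime
-- p ∣ e and write d = pᵇ·d' with p ∤ d' (b ≥ 1).  A unitary divisor absorbs the
-- full p-part of the number it divides, so pᵇ ∣ e ∣ m and, symmetrically, the
-- p-part of m is no larger than pᵇ.  Hence p^(2b) exactly divides n: an even
-- exponent, which the hypothesis forbids.  So gcud(d, n/d) = 1 for every d ∣ n.
module Submission where

open import Defs
open import Data.Nat using (ℕ; _<_)
open import Function.Bundles using (_⇔_)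

open import Data.Nat using (zero; suc; _*_; _+_; _^_; _≤_; _⊔_; z≤n; s≤s; z<s; _%_; NonZero; nonTrivial⇒n>1)
open import Data.Nat.Properties
open import Data.Nat.Divisibility
open import Data.Nat.DivMod using (m*n%n≡0)
open import Data.Nat.GCD using (gcd; gcd-zeroˡ)
open import Data.Nat.Coprimality using (Coprime; gcd≡1⇒coprime)
open import Data.Nat.Primality using (Prime; euclidsLemma; prime⇒nonZero; prime⇒nonTrivial)
open import Data.Nat.Primality.Factorisation using (factorise)
open import Data.Nat.ListAction using (sum)
open import Data.Nat.Induction using (<-wellFounded)
open import Induction.WellFounded using (Acc; acc)
open import Data.List using (List; []; _∷_; filter; map; upTo; foldr; length)
open import Data.List.Relation.Unary.All using (All; []; _∷_; tabulate)
open import Data.List.Membership.Propositional using (_∈_)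
open import Data.List.Membership.Propositional.Properties using (∈-filter⁺; ∈-filter⁻; ∈-map⁺; ∈-map⁻; ∈-upTo⁺)
open import Data.List.Membership.DecPropositional _≟_ using (_∈?_)
open import Data.List.Properties using (filter-all)
open import Data.Product using (∃; ∃₂; _×_; _,_)
open import Data.Sum using (inj₁; inj₂)
open import Data.Empty using (⊥-elim)
open import Relation.Nullary using (¬_; yes; no)
open import Relation.Binary.PropositionalEquality using (_≡_; _≢_; refl; sym; trans; cong; cong₂; subst; subst₂; module ≡-Reasoning)
open import Function.Bundles using (mk⇔)

factor-∣ : ∀ {d e f} → d ≡ e * f → e ∣ d
factor-∣ {e = e} {f} d≡ef = divides f (trans d≡ef (*-comm e f))

prime>1 : ∀ {p} → Prime p → 1 < p
prime>1 {p} pp = nonTrivial⇒n>1 p {{prime⇒nonTrivial pp}}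

prime≢1 : ∀ {p} → Prime p → p ≢ 1
prime≢1 pp refl = <-irrefl refl (prime>1 pp)

p-part : ∀ {p} → Prime p → ∀ d → 0 < d → ∃₂ λ b r → d ≡ p ^ b * r × ¬ p ∣ r
p-part {p} pp d 0<d = split d 0<d (<-wellFounded d)
  where
  split : ∀ d → 0 < d → Acc _<_ d → ∃₂ λ b r → d ≡ p ^ b * r × ¬ p ∣ r
  split d 0<d _ with p ∣? d
  split d 0<d _ | no p∤d = 0 , d , sym (*-identityˡ d) , p∤d
  split .(0 * p) () _ | yes (divides-refl zero)
  split .(suc q * p) _ (acc rec) | yes (divides-refl (suc q))
    with split (suc q) z<s (rec (m<m*n (suc q) p (prime>1 pp)))
  ... | b , r , q≡ , p∤r = suc b , r , q*p≡ , p∤r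
    where
    open ≡-Reasoning
    q*p≡ : suc q * p ≡ p ^ suc b * r
    q*p≡ = begin
      suc q * p        ≡⟨ *-comm (suc q) p ⟩
      p * suc q        ≡⟨ cong (p *_) q≡ ⟩
      p * (p ^ b * r)  ≡⟨ sym (*-assoc p (p ^ b) r) ⟩
      p ^ suc b * r    ∎

exact-power : ∀ {p n b r} → Prime p → n ≡ p ^ b * r → ¬ p ∣ r → ¬ p ^ suc b ∣ n
exact-power {p} {b = b} {r} pp n≡ p∤r p^[1+b]∣n = p∤r (*-cancelˡ-∣ (p ^ b) p^b*p∣p^b*r)
  where
  instance p^b≢0 : NonZero (p ^ b)
  p^b≢0 = m^n≢0 p b {{prime⇒nonZero pp}}
  p^b*p∣p^b*r : p ^ b * p ∣ p ^ b * r
  p^b*p∣p^b*r = subst₂ _∣_ (*-comm p (p ^ b)) n≡ p^[1+b]∣n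

exponent-positive : ∀ {p d b r} → p ∣ d → d ≡ p ^ b * r → ¬ p ∣ r → 1 ≤ b
exponent-positive {b = zero}  {r} p∣d refl p∤r = ⊥-elim (p∤r (subst (_ ∣_) (*-identityˡ r) p∣d))
exponent-positive {b = suc _} _ _ _ = s≤s z≤n

-- A unitary divisor e of e·f (gcd(e, f) = 1) absorbs the whole p-part of e·f
-- for every prime p ∣ e: since p ∤ f, each factor p must go into e.
unitary-absorbs : ∀ {p e f} → Prime p → p ∣ e → Coprime e f → ∀ j → p ^ j ∣ e * f → p ^ j ∣ e
unitary-absorbs pp p∣e cop zero _ = 1∣ _
unitary-absorbs {p} {f = f} pp p∣e cop (suc j) p^[1+j]∣ef
  with unitary-absorbs pp p∣e cop j (m*n∣⇒n∣ p (p ^ j) p^[1+j]∣ef)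
... | divides-refl q with euclidsLemma q f pp p∣qf
  where
  instance p^j≢0 : NonZero (p ^ j)
  p^j≢0 = m^n≢0 p j {{prime⇒nonZero pp}}
  open ≡-Reasoning
  rearrange : q * p ^ j * f ≡ p ^ j * (q * f)
  rearrange = begin
    q * p ^ j * f    ≡⟨ cong (_* f) (*-comm q (p ^ j)) ⟩
    p ^ j * q * f    ≡⟨ *-assoc (p ^ j) q f ⟩
    p ^ j * (q * f)  ∎
  p∣qf : p ∣ q * f
  p∣qf = *-cancelˡ-∣ (p ^ j) (subst₂ _∣_ (*-comm p (p ^ j)) rearrange p^[1+j]∣ef)
... | inj₁ p∣q = *-monoˡ-∣ (p ^ j) p∣q
... | inj₂ p∣f = ⊥-elim (prime≢1 pp (cop (p∣e , p∣f)))

even-double : ∀ b → (b + b) % 2 ≡ 0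
even-double b = subst (λ x → x % 2 ≡ 0) b*2≡b+b (m*n%n≡0 b 2)
  where
  b*2≡b+b : b * 2 ≡ b + b
  b*2≡b+b = trans (*-comm b 2) (cong (b +_) (+-identityʳ b))

common-unitary⇒even-exponent :
  ∀ {p e d f m g} → Prime p → p ∣ e → 0 < d →
  d ≡ e * f → Coprime e f → m ≡ e * g → Coprime e g →
  ∃ λ b → 1 ≤ b × p ^ (b + b) ∣ d * m × ¬ p ^ suc (b + b) ∣ d * m
common-unitary⇒even-exponent {p} {e} {d} {m = m} pp p∣e 0<d d≡ef cop-ef m≡eg cop-eg
  with p-part pp d 0<d
... | b , d' , d≡ , p∤d' with ∣-trans pᵇ∣e (factor-∣ m≡eg)
  where
  -- e absorbs the p-part pᵇ of d, and e ∣ m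
  pᵇ∣e : p ^ b ∣ e
  pᵇ∣e = unitary-absorbs pp p∣e cop-ef b (subst (p ^ b ∣_) d≡ef (factor-∣ d≡))
... | divides m' m≡ = b , 1≤b , p^[b+b]∣dm , exact-power {b = b + b} pp dm≡ p∤d'm'
  where
  e∣d : e ∣ d
  e∣d = factor-∣ d≡ef
  1≤b : 1 ≤ b
  1≤b = exponent-positive (∣-trans p∣e e∣d) d≡ p∤d'
  -- the p-part of m is no larger than pᵇ, since it is absorbed by e ∣ d
  p∤m' : ¬ p ∣ m'
  p∤m' p∣m' = exact-power {b = b} pp d≡ p∤d' (∣-trans p^[1+b]∣e e∣d)
    where
    p^[1+b]∣e : p ^ suc b ∣ e
    p^[1+b]∣e = unitary-absorbs pp p∣e cop-eg (suc b)
                  (subst (p ^ suc b ∣_) (trans (sym m≡) m≡eg) (*-monoˡ-∣ (p ^ b) p∣m'))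
  p∤d'm' : ¬ p ∣ d' * m'
  p∤d'm' p∣d'm' with euclidsLemma d' m' pp p∣d'm'
  ... | inj₁ p∣d' = p∤d' p∣d'
  ... | inj₂ p∣m' = p∤m' p∣m'
  open ≡-Reasoning
  dm≡ : d * m ≡ p ^ (b + b) * (d' * m')
  dm≡ = begin
    d * m                          ≡⟨ cong₂ _*_ d≡ m≡ ⟩
    p ^ b * d' * (m' * p ^ b)      ≡⟨ *-assoc (p ^ b) d' _ ⟩
    p ^ b * (d' * (m' * p ^ b))    ≡⟨ cong (p ^ b *_) (*-comm d' _) ⟩
    p ^ b * (m' * p ^ b * d')      ≡⟨ cong (λ x → p ^ b * (x * d')) (*-comm m' (p ^ b)) ⟩
    p ^ b * (p ^ b * m' * d')      ≡⟨ cong (p ^ b *_) (*-assoc (p ^ b) m' d') ⟩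
    p ^ b * (p ^ b * (m' * d'))    ≡⟨ sym (*-assoc (p ^ b) (p ^ b) _) ⟩
    p ^ b * p ^ b * (m' * d')      ≡⟨ cong₂ _*_ (sym (^-distribˡ-+-* p b b)) (*-comm m' d') ⟩
    p ^ (b + b) * (d' * m')        ∎
  p^[b+b]∣dm : p ^ (b + b) ∣ d * m
  p^[b+b]∣dm = factor-∣ dm≡

prime-divisor : ∀ e → 1 < e → ∃ λ p → Prime p × p ∣ e
prime-divisor e@(suc _) 1<e with factorise e
... | record { factors = [] ; isFactorisation = e≡1 } = ⊥-elim (<-irrefl (sym e≡1) 1<e)
... | record { factors = p ∷ ps ; isFactorisation = e≡ ; factorsPrime = pp ∷ _ } =
  p , pp , factor-∣ e≡

-- The common unitary divisors of d and m are trivial when d·m has only odd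
-- exponents: a prime dividing such a divisor would occur with an even exponent.
common-unitary-trivial : ∀ {n d e f m g} → AllExponentsOdd n → n ≡ d * m → 0 < d → 0 < e →
  d ≡ e * f → Coprime e f → m ≡ e * g → Coprime e g → e ≡ 1
common-unitary-trivial {e = e} odd n≡dm 0<d 0<e d≡ef cop-ef m≡eg cop-eg with e ≟ 1
... | yes e≡1 = e≡1
... | no e≢1 with prime-divisor e (≤∧≢⇒< 0<e (λ 1≡e → e≢1 (sym 1≡e)))
... | p , pp , p∣e with common-unitary⇒even-exponent pp p∣e 0<d d≡ef cop-ef m≡eg cop-eg
... | b , 1≤b , exact , not-higher = ⊥-elim (1≢0 (trans (sym odd-exponent) (even-double b)))
  where
  1≢0 : 1 ≢ 0
  1≢0 ()
  odd-exponent : (b + b) % 2 ≡ 1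
  odd-exponent = odd p (b + b) pp (≤-trans 1≤b (m≤m+n b b))
                   (subst (p ^ (b + b) ∣_) (sym n≡dm) exact)
                   (λ h → not-higher (subst (p ^ suc (b + b) ∣_) n≡dm h))

∈-divisors⁻ : ∀ {n x} → x ∈ divisors n → x ∣ n × 0 < x
∈-divisors⁻ {n} x∈ with ∈-filter⁻ (_∣? n) {xs = map suc (upTo n)} x∈
... | x∈map , x∣n with ∈-map⁻ suc x∈map
... | _ , _ , refl = x∣n , z<s

∈-divisors⁺ : ∀ {n x} → 0 < n → 0 < x → x ∣ n → x ∈ divisors n
∈-divisors⁺ {n@(suc _)} {suc _} _ _ x∣n =
  ∈-filter⁺ (_∣? n) {xs = map suc (upTo n)} (∈-map⁺ suc (∈-upTo⁺ (∣⇒≤ x∣n))) x∣n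

cof-spec : ∀ {n d} → 0 < d → d ∣ n → n ≡ d * cof n d
cof-spec {n} {d@(suc _)} _ d∣n = trans (m∣n⇒n≡m*quotient d∣n) (cong (d *_) (sym (n/m≡quotient d∣n)))

cof-positive : ∀ {n d} → 0 < n → 0 < d → d ∣ n → 0 < cof n d
cof-positive {n} {d} 0<n 0<d d∣n with cof n d | cof-spec {n} {d} 0<d d∣n
... | zero  | n≡0 = ⊥-elim (<-irrefl (sym (trans n≡0 (*-zeroʳ d))) 0<n)
... | suc _ | _   = z<s

∈-unitary⁻ : ∀ {d e} → e ∈ unitaryDivisors d → 0 < e × d ≡ e * cof d e × Coprime e (cof d e)
∈-unitary⁻ {d} {e} e∈ with ∈-filter⁻ (λ e → gcd e (cof d e) ≟ 1) {xs = divisors d} e∈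
... | e∈divs , gcd≡1 with ∈-divisors⁻ {d} e∈divs
... | e∣d , 0<e = 0<e , cof-spec 0<e e∣d , gcd≡1⇒coprime gcd≡1

1∈unitary : ∀ {d} → 0 < d → 1 ∈ unitaryDivisors d
1∈unitary {d} 0<d = ∈-filter⁺ (λ e → gcd e (cof d e) ≟ 1) {xs = divisors d}
  (∈-divisors⁺ 0<d z<s (1∣ d)) (gcd-zeroˡ (cof d 1))

max-of-ones : ∀ {xs} → All (_≡ 1) xs → 1 ∈ xs → foldr _⊔_ 0 xs ≡ 1
max-of-ones (refl ∷ ones) _ = m≥n⇒m⊔n≡m (max≤1 ones)
  where
  max≤1 : ∀ {xs} → All (_≡ 1) xs → foldr _⊔_ 0 xs ≤ 1
  max≤1 []            = z≤n
  max≤1 (refl ∷ ones) = ⊔-lub ≤-refl (max≤1 ones)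

gcud≡1 : ∀ {a b} → 0 < a → 0 < b →
  (∀ {e} → e ∈ unitaryDivisors a → e ∈ unitaryDivisors b → e ≡ 1) → gcud a b ≡ 1
gcud≡1 {a} {b} 0<a 0<b only-1 = max-of-ones (tabulate common⇒1) (∈-filter⁺ common? (1∈unitary 0<a) (1∈unitary 0<b))
  where
  common? = λ e → e ∈? unitaryDivisors b
  common⇒1 : ∀ {e} → e ∈ filter common? (unitaryDivisors a) → e ≡ 1
  common⇒1 e∈ with ∈-filter⁻ common? {xs = unitaryDivisors a} e∈
  ... | e∈a , e∈b = only-1 e∈a e∈b

biUnitaryDivisors≡divisors : ∀ {n} → 1 < n → AllExponentsOdd n → biUnitaryDivisors n ≡ divisors n
biUnitaryDivisors≡divisors {n} 1<n odd = filter-all (λ d → gcud d (cof n d) ≟ 1) (tabulate bi-unitary)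
  where
  0<n : 0 < n
  0<n = <-trans z<s 1<n
  bi-unitary : ∀ {d} → d ∈ divisors n → gcud d (cof n d) ≡ 1
  bi-unitary {d} d∈ with ∈-divisors⁻ {n} d∈
  ... | d∣n , 0<d = gcud≡1 0<d (cof-positive 0<n 0<d d∣n) common-trivial
    where
    common-trivial : ∀ {e} → e ∈ unitaryDivisors d → e ∈ unitaryDivisors (cof n d) → e ≡ 1
    common-trivial {e} e∈d e∈m with ∈-unitary⁻ {d} e∈d | ∈-unitary⁻ {cof n d} e∈m
    ... | 0<e , d≡ , cop-d | _ , m≡ , cop-m =
      common-unitary-trivial odd (cof-spec 0<d d∣n) 0<d 0<e d≡ cop-d m≡ cop-m

theorem2 : ∀ (n : ℕ) → 1 < n → AllExponentsOdd n → (BiUnitaryHarmonic n ⇔ Harmonic n)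
theorem2 n 1<n odd = mk⇔ (subst HarmonicFor lists≡) (subst HarmonicFor (sym lists≡))
  where
  -- both notions are "sum L ∣ n * length L" for their list L of divisors
  HarmonicFor : List ℕ → Set
  HarmonicFor L = sum L ∣ n * length L
  lists≡ : biUnitaryDivisors n ≡ divisors n
  lists≡ = biUnitaryDivisors≡divisors 1<n odd
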